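{- Let $m\ge 2$ and let $f_3:\{0,1,\dots,m\}\to\{0,1,\dots,m\}$ be the reduced three-digit Kaprekar map. For every integer $a$ with $1\le a\le m$, $$f_3(a)=\begin{cases} a-1 & \text{if } a\ge \frac{m+1}{2},\\ m-a & \text{if } a<\frac{m+1}{2}.\end{cases}$$ Equivalently, $f(a(m^2-1))=(a-1)(m^2-1)$ if $a\ge\frac{m+1}{2}$ and $f(a(m^2-1))=(m-a)(m^2-1)$ if $a<\frac{m+1}{2}$.
   Context: Let $X=\{0,1,\dots,m^3-1\}$, each element written with exactly three base-$m$ digits (leading zeros allowed). Let $f:X\to X$, $f(x)=D(x)-A(x)$. Here $D(x)$ (resp. $A(x)$) is the three-digit base-$m$ number formed by the digits of $x$ in descending (resp. ascending) order. For every $x$, $f(x)$ is a multiple of $m^2-1$. For $0\le a\le m$ we have $a(m^2-1)\in X$. The reduced map is defined by $f_3(a)=f(a(m^2-1))/(m^2-1)$. -}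

module Defs where

open import Data.Nat using (ℕ; suc; _+_; _*_; _∸_; _⊔_; _⊓_; NonZero)
open import Data.Nat.DivMod using (_/_; _%_)

-- Three-digit base-m Kaprekar map, for a base m ≥ 1 (NonZero m).
-- x ∈ X = {0,…,m³-1} is written with digits d₂ d₁ d₀ (leading zeros allowed).

d₀ d₁ d₂ : (m : ℕ) → .{{_ : NonZero m}} → ℕ → ℕ
d₀ m x = x % m
d₁ m x = (x / m) % m
d₂ m x = ((x / m) / m) % m

dmax dmin dmid : (m : ℕ) → .{{_ : NonZero m}} → ℕ → ℕ
dmax m x = d₂ m x ⊔ (d₁ m x ⊔ d₀ m x)
dmin m x = d₂ m x ⊓ (d₁ m x ⊓ d₀ m x)
dmid m x = ((d₂ m x + d₁ m x + d₀ m x) ∸ dmax m x) ∸ dmin m x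

D A : (m : ℕ) → .{{_ : NonZero m}} → ℕ → ℕ
D m x = dmax m x * (m * m) + dmid m x * m + dmin m x
A m x = dmin m x * (m * m) + dmid m x * m + dmax m x

-- Kaprekar map f(x) = D(x) - A(x)  (D(x) ≥ A(x) always, so ∸ is exact)
f : (m : ℕ) → .{{_ : NonZero m}} → ℕ → ℕ
f m x = D m x ∸ A m x

f₃ : (m : ℕ) → .{{_ : NonZero (m * m ∸ 1)}} → .{{_ : NonZero m}} → ℕ → ℕ
f₃ m a = f m (a * (m * m ∸ 1)) / (m * m ∸ 1)

{-# OPTIONS --safe #-}
-- Writing a = b + 1 and m - a = c, so that b + c = m - 1, the number a(m² - 1)
-- has base-m digits b, m - 1, c.  Since D(x) - A(x) = (dmax - dmin)(m² - 1)
-- for every x, the middle digit cancels and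
-- f₃(a) = (m - 1) - min(b, c) = max(b, c) = max(a - 1, m - a).
module Submission where

open import Defs
open import Data.Nat using (ℕ; suc; _+_; _*_; _∸_; _≤_; _<_; _⊔_; _⊓_; NonZero; s≤s)
open import Data.Nat.Properties
open import Data.Nat.DivMod
open import Data.Nat.Divisibility using (divides-refl)
open import Data.Nat.Tactic.RingSolver using (solve-∀)
open import Data.Product using (_×_; _,_)
open import Data.Sum using (inj₁; inj₂)
open import Relation.Binary.PropositionalEquality

module _ {n : ℕ} .{{_ : NonZero n}} where

  [r+qn]%n≡r : ∀ r q → r < n → (r + q * n) % n ≡ r
  [r+qn]%n≡r r q r<n = trans ([m+kn]%n≡m%n r q n) (m<n⇒m%n≡m r<n)

  [r+qn]/n≡q : ∀ r q → r < n → (r + q * n) / n ≡ q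
  [r+qn]/n≡q r q r<n =
    trans (+-distrib-/-∣ʳ r (divides-refl q)) (cong₂ _+_ (m<n⇒m/n≡0 r<n) (m*n/n≡m q n))

digits-horner : ∀ m .{{_ : NonZero m}} {r₀ r₁ r₂} → r₀ < m → r₁ < m → r₂ < m →
  let x = r₀ + (r₁ + r₂ * m) * m in d₂ m x ≡ r₂ × d₁ m x ≡ r₁ × d₀ m x ≡ r₀
digits-horner m {r₀} {r₁} {r₂} r₀<m r₁<m r₂<m =
  trans (cong (λ y → (y / m) % m) x/m≡r₁+r₂m)
        (trans (cong (_% m) ([r+qn]/n≡q r₁ r₂ r₁<m)) (m<n⇒m%n≡m r₂<m)) ,
  trans (cong (_% m) x/m≡r₁+r₂m) ([r+qn]%n≡r r₁ r₂ r₁<m) ,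
  [r+qn]%n≡r r₀ (r₁ + r₂ * m) r₀<m
  where
  x/m≡r₁+r₂m : (r₀ + (r₁ + r₂ * m) * m) / m ≡ r₁ + r₂ * m
  x/m≡r₁+r₂m = [r+qn]/n≡q r₀ (r₁ + r₂ * m) r₀<m

[hw+v+l]∸[lw+v+h]≡[h∸l][w∸1] : ∀ h l v w → l ≤ h →
  (h * w + v + l) ∸ (l * w + v + h) ≡ (h ∸ l) * (w ∸ 1)
[hw+v+l]∸[lw+v+h]≡[h∸l][w∸1] h l v w l≤h with m≤n⇒∃[o]m+o≡n l≤h
... | d , refl = begin
  ((l + d) * w + v + l) ∸ (l * w + v + (l + d)) ≡⟨ cong₂ _∸_ (split-high l d v w) (split-low l d v w) ⟩
  (l * w + v + l + d * w) ∸ (l * w + v + l + d)  ≡⟨ [m+n]∸[m+o]≡n∸o (l * w + v + l) (d * w) d ⟩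
  d * w ∸ d                                      ≡⟨ cong (d * w ∸_) (*-identityʳ d) ⟨
  d * w ∸ d * 1                                  ≡⟨ *-distribˡ-∸ d w 1 ⟨
  d * (w ∸ 1)                                    ≡⟨ cong (_* (w ∸ 1)) (m+n∸m≡n l d) ⟨
  (l + d ∸ l) * (w ∸ 1)                          ∎
  where
  open ≡-Reasoning
  split-high : ∀ l d v w → (l + d) * w + v + l ≡ l * w + v + l + d * w
  split-high = solve-∀
  split-low : ∀ l d v w → l * w + v + (l + d) ≡ l * w + v + l + d
  split-low = solve-∀

f≡[dmax∸dmin]*[m²∸1] : ∀ m .{{_ : NonZero m}} x → f m x ≡ (dmax m x ∸ dmin m x) * (m * m ∸ 1)
f≡[dmax∸dmin]*[m²∸1] m x =
  [hw+v+l]∸[lw+v+h]≡[h∸l][w∸1] (dmax m x) (dmin m x) (dmid m x * m) (m * m)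
    (≤-trans (m⊓n≤m (d₂ m x) _) (m≤m⊔n (d₂ m x) _))

f₃≡dmax∸dmin : ∀ m .{{_ : NonZero (m * m ∸ 1)}} .{{_ : NonZero m}} a →
  let x = a * (m * m ∸ 1) in f₃ m a ≡ dmax m x ∸ dmin m x
f₃≡dmax∸dmin m a = trans (cong (_/ (m * m ∸ 1)) (f≡[dmax∸dmin]*[m²∸1] m (a * (m * m ∸ 1))))
                         (m*n/n≡m _ (m * m ∸ 1))

m+n∸m⊓n≡m⊔n : ∀ m n → (m + n) ∸ (m ⊓ n) ≡ m ⊔ n
m+n∸m⊓n≡m⊔n m n with ≤-total m n
... | inj₁ m≤n rewrite m≤n⇒m⊓n≡m m≤n | m≤n⇒m⊔n≡n m≤n = m+n∸m≡n m n
... | inj₂ n≤m rewrite m≥n⇒m⊓n≡n n≤m | m≥n⇒m⊔n≡m n≤m = m+n∸n≡m m n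

module _ (k b c : ℕ) (b+c≡s : b + c ≡ suc k) where
  private
    s = suc k
    m = suc s
    b≤s : b ≤ s
    b≤s = subst (b ≤_) b+c≡s (m≤m+n b c)
    c≤s : c ≤ s
    c≤s = subst (c ≤_) b+c≡s (m≤n+m c b)

  [b+1][m²∸1]≡horner : suc b * (m * m ∸ 1) ≡ c + (s + b * m) * m
  -- m * m ∸ 1 reduces to s + s * m, which makes this a ring identity after substituting s = b + c.
  [b+1][m²∸1]≡horner = subst (λ t → suc b * (t + t * suc t) ≡ c + (t + b * suc t) * suc t) b+c≡s
                         (identity b c)
    where
    identity : ∀ b c → suc b * ((b + c) + (b + c) * suc (b + c))
                     ≡ c + ((b + c) + b * suc (b + c)) * suc (b + c)
    identity = solve-∀

  f₃[b+1]≡b⊔c : f₃ m (suc b) ≡ b ⊔ c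
  f₃[b+1]≡b⊔c with digits-horner m (s≤s c≤s) ≤-refl (s≤s b≤s)
  ... | d₂≡b , d₁≡s , d₀≡c = begin
    f₃ m (suc b)                              ≡⟨ f₃≡dmax∸dmin m (suc b) ⟩
    dmax m (suc b * (m * m ∸ 1)) ∸ dmin m (suc b * (m * m ∸ 1))
      ≡⟨ cong (λ x → dmax m x ∸ dmin m x) [b+1][m²∸1]≡horner ⟩
    dmax m x ∸ dmin m x                       ≡⟨ cong-spread d₂≡b d₁≡s d₀≡c ⟩
    b ⊔ (s ⊔ c) ∸ b ⊓ (s ⊓ c)
      ≡⟨ cong₂ (λ p q → b ⊔ p ∸ b ⊓ q) (m≥n⇒m⊔n≡m c≤s) (m≥n⇒m⊓n≡n c≤s) ⟩
    b ⊔ s ∸ b ⊓ c                             ≡⟨ cong (_∸ b ⊓ c) (m≤n⇒m⊔n≡n b≤s) ⟩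
    s ∸ b ⊓ c                                 ≡⟨ cong (_∸ b ⊓ c) b+c≡s ⟨
    b + c ∸ b ⊓ c                             ≡⟨ m+n∸m⊓n≡m⊔n b c ⟩
    b ⊔ c                                     ∎
    where
    open ≡-Reasoning
    x : ℕ
    x = c + (s + b * m) * m
    cong-spread : ∀ {p q r p′ q′ r′} → p ≡ p′ → q ≡ q′ → r ≡ r′ →
                  p ⊔ (q ⊔ r) ∸ p ⊓ (q ⊓ r) ≡ p′ ⊔ (q′ ⊔ r′) ∸ p′ ⊓ (q′ ⊓ r′)
    cong-spread refl refl refl = refl

lemma3p2p2 : (k : ℕ) → (a : ℕ) → 1 ≤ a → a ≤ suc (suc k) →
    (suc (suc k) + 1 ≤ 2 * a → f₃ (suc (suc k)) a ≡ a ∸ 1) ×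
    (2 * a < suc (suc k) + 1 → f₃ (suc (suc k)) a ≡ suc (suc k) ∸ a)
lemma3p2p2 k (suc b) _ (s≤s b≤s) with m≤n⇒∃[o]m+o≡n b≤s
... | c , b+c≡s = upper , lower
  where
  m+1≡2+[b+c] : suc (suc k) + 1 ≡ 2 + (b + c)
  m+1≡2+[b+c] = trans (+-comm (suc (suc k)) 1) (cong (2 +_) (sym b+c≡s))
  2a≡2+[b+b] : 2 * suc b ≡ 2 + (b + b)
  2a≡2+[b+b] = double b
    where
    double : ∀ b → 2 * suc b ≡ 2 + (b + b)
    double = solve-∀
  f₃≡b⊔c : f₃ (suc (suc k)) (suc b) ≡ b ⊔ c
  f₃≡b⊔c = f₃[b+1]≡b⊔c k b c b+c≡s

  upper : suc (suc k) + 1 ≤ 2 * suc b → f₃ (suc (suc k)) (suc b) ≡ b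
  upper m+1≤2a = trans f₃≡b⊔c (m≥n⇒m⊔n≡m c≤b)
    where
    c≤b : c ≤ b
    c≤b = +-cancelˡ-≤ (2 + b) c b (subst₂ _≤_ m+1≡2+[b+c] 2a≡2+[b+b] m+1≤2a)

  lower : 2 * suc b < suc (suc k) + 1 → f₃ (suc (suc k)) (suc b) ≡ suc k ∸ b
  lower 2a<m+1 = begin
    f₃ (suc (suc k)) (suc b) ≡⟨ f₃≡b⊔c ⟩
    b ⊔ c                    ≡⟨ m≤n⇒m⊔n≡n (<⇒≤ b<c) ⟩
    c                        ≡⟨ m+n∸m≡n b c ⟨
    b + c ∸ b                ≡⟨ cong (_∸ b) b+c≡s ⟩
    suc k ∸ b                ∎
    where
    open ≡-Reasoning
    b<c : b < c
    b<c = +-cancelˡ-< (2 + b) b c (subst₂ _<_ 2a≡2+[b+b] m+1≡2+[b+c] 2a<m+1)
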